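{- Let $\Phi:(S,\cdot)\to(T,\cdot)$ be a semigroup homomorphism such that $\Phi(S)$ is a $J$-set in $T$. If $A\subseteq S$ is a $C$-set in $S$, then $\Phi(A)$ is a $C$-set in $T$.
   Context: For a semigroup $(X,\cdot)$, $B\subseteq X$ and $x\in X$, let $x^{ -1}B=\{y\in X:x\cdot y\in B\}$; for a set $Y$, $\mathcal P_f(Y)$ denotes the set of finite nonempty subsets of $Y$. Let $\mathcal T_X={}^{\mathbb N}X$; for $m\in\mathbb N$ let $\mathcal J_m=\{(t(1),\dots,t(m))\in\mathbb N^m:t(1)<\dots<t(m)\}$; for $a\in X^{m+1}$, $t\in\mathcal J_m$, $f\in\mathcal T_X$ put $x(m,a,t,f)=\bigl(\prod_{j=1}^m a(j)\cdot f(t(j))\bigr)\cdot a(m+1)$. A set $B\subseteq X$ is a $J$-set in $X$ if for each $F\in\mathcal P_f(\mathcal T_X)$ there exist $m\in\mathbb N$, $a\in X^{m+1}$, $t\in\mathcal J_m$ with $x(m,a,t,f)\in B$ for every $f\in F$. A family $\langle C_F\rangle_{F\in\mathcal I}$ is downward directed if $(\mathcal I,\geq)$ is directed and $F\geq G$ implies $C_F\subseteq C_G$. A set $A\subseteq X$ is a $C$-set in $X$ if there is a downward directed family $\langle C_F\rangle_{F\in\mathcal I}$ of subsets of $A$ such that (1) for each $F\in\mathcal I$ and each $x\in C_F$ there is $G\in\mathcal I$ with $C_G\subseteq x^{ -1}C_F$, and (2) for each $\mathcal F\in\mathcal P_f(\mathcal I)$, $\bigcap_{F\in\mathcal F}C_F$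 is a $J$-set in $X$. -}

module Defs where

open import Level using (0ℓ)
open import Data.Nat using (ℕ; suc; _<_)
open import Data.Fin using (Fin; zero; suc; inject₁; fromℕ)
open import Data.List using (List; _∷_)
open import Data.List.Membership.Propositional using (_∈_)
open import Data.Product using (Σ; _×_; ∃; ∃-syntax; _,_)
open import Relation.Binary.PropositionalEquality using (_≡_)

record SemigroupOn (X : Set) : Set where
  field
    _·_   : X → X → X
    assoc : ∀ x y z → (x · y) · z ≡ x · (y · z)

Subset : Set → Set₁
Subset X = X → Set

_⊆_ : {X : Set} → Subset X → Subset X → Set
A ⊆ B = ∀ x → A x → B x

module _ {X : Set} (SX : SemigroupOn X) where
  open SemigroupOn SX

  _⁻¹_ : X → Subset X → Subset X
  (x ⁻¹ B) y = B (x · y)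

  𝒯 : Set
  𝒯 = ℕ → X

  StrictlyIncreasing : {m : ℕ} → (Fin m → ℕ) → Set
  StrictlyIncreasing {m} t = ∀ (i j : Fin m) → Data.Fin._<_ i j → t i < t j

  -- x(m,a,t,f) = (∏_{j=1}^m a(j)·f(t(j))) · a(m+1), for m ≥ 1, written with m = suc k.
  -- prod k a t f = ∏_{j=1}^{k+1} a(j)·f(t(j)), left-associated (associativity makes this irrelevant).
  prod : (k : ℕ) → (Fin (suc (suc k)) → X) → (Fin (suc k) → ℕ) → 𝒯 → X
  prod ℕ.zero    a t f = a zero · f (t zero)
  prod (suc k) a t f =
    prod k (λ i → a (inject₁ i)) (λ i → t (inject₁ i)) f
      · (a (inject₁ (fromℕ (suc k))) · f (t (fromℕ (suc k))))

  xval : (k : ℕ) → (Fin (suc (suc k)) → X) → (Fin (suc k) → ℕ) → 𝒯 → X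
  xval k a t f = prod k a t f · a (fromℕ (suc k))

  -- Finite nonempty subsets represented as nonempty lists.
  -- B is a J-set: for every finite nonempty F ⊆ 𝒯_X there are m ≥ 1, a ∈ X^{m+1},
  -- t ∈ 𝒥_m with x(m,a,t,f) ∈ B for all f ∈ F.
  IsJSet : Subset X → Set
  IsJSet B =
    ∀ (f₀ : 𝒯) (Fs : List 𝒯) →
      ∃[ k ] Σ (Fin (suc (suc k)) → X) λ a → Σ (Fin (suc k) → ℕ) λ t →
        StrictlyIncreasing t × (∀ f → f ∈ (f₀ ∷ Fs) → B (xval k a t f))

  record CSetWitness (A : Subset X) : Set₁ where
    field
      I        : Set
      _≥_      : I → I → Set
      inhabited : I
      ≥-refl   : ∀ F → F ≥ F
      ≥-trans  : ∀ {F G H} → F ≥ G → G ≥ H → F ≥ H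
      directed : ∀ F G → ∃[ H ] (H ≥ F × H ≥ G)
      C        : I → Subset X
      C⊆A      : ∀ F → C F ⊆ A
      downward : ∀ {F G} → F ≥ G → C F ⊆ C G
      cond1    : ∀ F x → C F x → ∃[ G ] (C G ⊆ (x ⁻¹ C F))
      cond2    : ∀ (F₀ : I) (Fs : List I) →
                   IsJSet (λ x → ∀ F → F ∈ (F₀ ∷ Fs) → C F x)

  IsCSet : Subset X → Set₁
  IsCSet A = CSetWitness A

IsHom : {S T : Set} → SemigroupOn S → SemigroupOn T → (S → T) → Set
IsHom SS ST Φ = ∀ x y → Φ (SemigroupOn._·_ SS x y) ≡ SemigroupOn._·_ ST (Φ x) (Φ y)

image : {S T : Set} → (S → T) → Subset S → Subset T
image Φ A t = ∃[ s ] (A s × Φ s ≡ t)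

module Submission where

-- The C-set structure of A is
-- transported along Φ: the family ⟨Φ(C_F)⟩ is still downward directed, condition (1)
-- survives because Φ(x·y) = Φ(x)·Φ(y), and condition (2) reduces to the key lemma
-- J-image: Φ maps J-sets in S to J-sets in T (J-sets being closed upwards, and
-- Φ(⋂ C_F) ⊆ ⋂ Φ(C_F)).
--
-- An expression x(m,a,t,f) is handled as a *word* (aⱼ,tⱼ)ⱼ with a
-- tail coefficient.  Given finitely many f ∈ F in T, use that Φ(S) is a J-set to choose
-- words wₙ with tails zₙ whose indices lie in consecutive disjoint windows, and
-- preimages gᶠ(n) ∈ S of value(wₙ,f)·zₙ.  As B is a J-set, some x = value(V,gᶠ)·e lies in
-- B for all f.  Then Φ(x) = value(Φ V, Φ∘gᶠ)·Φ(e), and substituting the word wₙ for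
-- every letter with index n of Φ V yields a single increasing word U with
-- Φ(x) = value(U,f)·(tail) for all f ∈ F: a J-set witness for Φ(B).

open import Defs
open import Data.Unit using (⊤; tt)
open import Data.Nat using (ℕ; zero; suc; _+_; _≤_; _<_; _≤′_; ≤′-refl; ≤′-step; z≤n; s≤s)
open import Data.Nat.Properties using (≤-refl; ≤-trans; ≤-<-trans; <⇒≤; ≤⇒≤′; m≤m+n; +-monoʳ-<)
open import Data.Fin as Fin using (Fin; zero; suc; inject₁; fromℕ)
open import Data.Fin.Properties using (toℕ-inject₁; i<1+i; ℕ<⇒inject₁<)
open import Data.List using (List; _∷_; map)
open import Data.List.Membership.Propositional using (_∈_; mapWith∈)
open import Data.List.Membership.Propositional.Properties using (∈-map⁺)
open import Data.List.Relation.Unary.Any using (here; there)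
open import Data.Product using (Σ; _×_; ∃-syntax; _,_; proj₁; proj₂)
open import Function using (_∘_)
open import Relation.Binary.PropositionalEquality

-- Strict increase of a tuple of indices (the predicate StrictlyIncreasing of Defs, which
-- does not depend on the semigroup it is parameterised by).
Increasingᶠ : {m : ℕ} → (Fin m → ℕ) → Set
Increasingᶠ {m} t = ∀ (i j : Fin m) → i Fin.< j → t i < t j

_▷_ : {A : Set} {m : ℕ} → (Fin m → A) → A → Fin (suc m) → A
_▷_ {m = zero}  g z zero    = z
_▷_ {m = suc m} g z zero    = g zero
_▷_ {m = suc m} g z (suc i) = ((g ∘ suc) ▷ z) i

▷-inject₁ : {A : Set} {m : ℕ} (g : Fin m → A) (z : A) (i : Fin m) → (g ▷ z) (inject₁ i) ≡ g i
▷-inject₁ {m = suc m} g z zero    = refl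
▷-inject₁ {m = suc m} g z (suc i) = ▷-inject₁ (g ∘ suc) z i

▷-last : {A : Set} (m : ℕ) (g : Fin m → A) (z : A) → (g ▷ z) (fromℕ m) ≡ z
▷-last zero    g z = refl
▷-last (suc m) g z = ▷-last m (g ∘ suc) z

▷-bounded : {m : ℕ} (g : Fin m → ℕ) (n : ℕ) → (∀ i → g i ≤ n) → ∀ j → (g ▷ n) j ≤ n
▷-bounded {zero}  g n g≤n zero    = ≤-refl
▷-bounded {suc m} g n g≤n zero    = g≤n zero
▷-bounded {suc m} g n g≤n (suc j) = ▷-bounded (g ∘ suc) n (g≤n ∘ suc) j

▷-above : {m : ℕ} (g : Fin m → ℕ) (n c : ℕ) → (∀ i → c < g i) → c < n → ∀ j → c < (g ▷ n) j
▷-above {zero}  g n c c<g c<n zero    = c<n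
▷-above {suc m} g n c c<g c<n zero    = c<g zero
▷-above {suc m} g n c c<g c<n (suc j) = ▷-above (g ∘ suc) n c (c<g ∘ suc) c<n j

▷-increasing : {m : ℕ} (g : Fin m → ℕ) (n : ℕ) → Increasingᶠ g → (∀ i → g i < n) →
  Increasingᶠ (g ▷ n)
▷-increasing {zero}  g n inc g<n zero    zero    ()
▷-increasing {suc m} g n inc g<n zero    zero    ()
▷-increasing {suc m} g n inc g<n zero    (suc j) _ =
  ▷-above (g ∘ suc) n (g zero) (λ i → inc zero (suc i) (s≤s z≤n)) (g<n zero) j
▷-increasing {suc m} g n inc g<n (suc i) zero    ()
▷-increasing {suc m} g n inc g<n (suc i) (suc j) (s≤s i<j) =
  ▷-increasing (g ∘ suc) n (λ i j i<j → inc (suc i) (suc j) (s≤s i<j)) (g<n ∘ suc) i j i<j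

monotone : (a : ℕ → ℕ) → (∀ n → a n ≤ a (suc n)) → ∀ {m n} → m ≤′ n → a m ≤ a n
monotone a step ≤′-refl       = ≤-refl
monotone a step (≤′-step m≤n) = ≤-trans (monotone a step m≤n) (step _)

inject₁-< : {m : ℕ} {i j : Fin m} → i Fin.< j → inject₁ i Fin.< inject₁ j
inject₁-< {i = i} {j} = subst₂ _<_ (sym (toℕ-inject₁ i)) (sym (toℕ-inject₁ j))

-- With a tail coefficient it encodes the data (m, a, t) of an
-- expression x(m,a,t,f).
data Word (X : Set) : Set where
  single : X → ℕ → Word X
  snoc   : Word X → X → ℕ → Word X

module _ {X : Set} where

  firstIndex lastIndex : Word X → ℕ
  firstIndex (single a n) = n
  firstIndex (snoc w a n) = firstIndex w
  lastIndex  (single a n) = n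
  lastIndex  (snoc w a n) = n

  Increasing : Word X → Set
  Increasing (single a n) = ⊤
  Increasing (snoc w a n) = Increasing w × lastIndex w < n

  first≤last : ∀ w → Increasing w → firstIndex w ≤ lastIndex w
  first≤last (single a n) _            = ≤-refl
  first≤last (snoc w a n) (incw , w<n) = <⇒≤ (≤-<-trans (first≤last w incw) w<n)

  _++ʷ_ : Word X → Word X → Word X
  w ++ʷ single a n = snoc w a n
  w ++ʷ snoc v a n = snoc (w ++ʷ v) a n

  last-++ : ∀ w v → lastIndex (w ++ʷ v) ≡ lastIndex v
  last-++ w (single a n) = refl
  last-++ w (snoc v a n) = refl

  increasing-++ : ∀ w v → Increasing w → Increasing v → lastIndex w < firstIndex v →
    Increasing (w ++ʷ v)
  increasing-++ w (single a n) incw _            w<v = incw , w<v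
  increasing-++ w (snoc v a n) incw (incv , v<n) w<v =
    increasing-++ w v incw incv w<v , subst (_< n) (sym (last-++ w v)) v<n

  shift : ℕ → Word X → Word X
  shift M (single a n) = single a (M + n)
  shift M (snoc w a n) = snoc (shift M w) a (M + n)

  first-shift : ∀ M w → firstIndex (shift M w) ≡ M + firstIndex w
  first-shift M (single a n) = refl
  first-shift M (snoc w a n) = first-shift M w

  increasing-shift : ∀ M w → Increasing w → Increasing (shift M w)
  increasing-shift M (single a n) _            = tt
  increasing-shift M (snoc w a n) (incw , w<n) =
    increasing-shift M w incw , subst (_< M + n) (sym (last-shift w)) (+-monoʳ-< M w<n)
    where
      last-shift : ∀ w → lastIndex (shift M w) ≡ M + lastIndex w
      last-shift (single a n) = refl
      last-shift (snoc w a n) = refl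

  length : Word X → ℕ
  length (single a n) = zero
  length (snoc w a n) = suc (length w)

  coefficients : (w : Word X) → Fin (suc (length w)) → X
  coefficients (single a n) _ = a
  coefficients (snoc w a n)   = coefficients w ▷ a

  indices : (w : Word X) → Fin (suc (length w)) → ℕ
  indices (single a n) _ = n
  indices (snoc w a n)   = indices w ▷ n

  indices-bounded : ∀ w → Increasing w → ∀ i → indices w i ≤ lastIndex w
  indices-bounded (single a n) _            i = ≤-refl
  indices-bounded (snoc w a n) (incw , w<n) =
    ▷-bounded (indices w) n (λ i → <⇒≤ (≤-<-trans (indices-bounded w incw i) w<n))

  indices-increasing : ∀ w → Increasing w → Increasingᶠ (indices w)
  indices-increasing (single a n) _            zero zero ()
  indices-increasing (snoc w a n) (incw , w<n) =
    ▷-increasing (indices w) n (indices-increasing w incw)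
      (λ i → ≤-<-trans (indices-bounded w incw i) w<n)

mapʷ : {X Y : Set} → (X → Y) → Word X → Word Y
mapʷ φ (single a n) = single (φ a) n
mapʷ φ (snoc w a n) = snoc (mapʷ φ w) (φ a) n

last-mapʷ : {X Y : Set} (φ : X → Y) (w : Word X) → lastIndex (mapʷ φ w) ≡ lastIndex w
last-mapʷ φ (single a n) = refl
last-mapʷ φ (snoc w a n) = refl

increasing-mapʷ : {X Y : Set} (φ : X → Y) (w : Word X) → Increasing w → Increasing (mapʷ φ w)
increasing-mapʷ φ (single a n) _            = tt
increasing-mapʷ φ (snoc w a n) (incw , w<n) =
  increasing-mapʷ φ w incw , subst (_< n) (sym (last-mapʷ φ w)) w<n

module Words {X : Set} (SX : SemigroupOn X) where
  open SemigroupOn SX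

  -- value w f = ∏ⱼ aⱼ · f(tⱼ), so that x(m,a,t,f) = value w f · a(m+1).
  value : Word X → (ℕ → X) → X
  value (single a n) f = a · f n
  value (snoc w a n) f = value w f · (a · f n)

  value-++ : ∀ w v f → value (w ++ʷ v) f ≡ value w f · value v f
  value-++ w (single a n) f = refl
  value-++ w (snoc v a n) f = trans (cong (_· (a · f n)) (value-++ w v f)) (assoc _ _ _)

  value-shift : ∀ M w f → value (shift M w) f ≡ value w (λ n → f (M + n))
  value-shift M (single a n) f = refl
  value-shift M (snoc w a n) f = cong (_· (a · f (M + n))) (value-shift M w f)

  _◃_ : X → Word X → Word X
  c ◃ single a n = single (c · a) n
  c ◃ snoc w a n = snoc (c ◃ w) a n

  value-◃ : ∀ c w f → value (c ◃ w) f ≡ c · value w f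
  value-◃ c (single a n) f = assoc _ _ _
  value-◃ c (snoc w a n) f = trans (cong (_· (a · f n)) (value-◃ c w f)) (assoc _ _ _)

  first-◃ : ∀ c w → firstIndex (c ◃ w) ≡ firstIndex w
  first-◃ c (single a n) = refl
  first-◃ c (snoc w a n) = first-◃ c w

  last-◃ : ∀ c w → lastIndex (c ◃ w) ≡ lastIndex w
  last-◃ c (single a n) = refl
  last-◃ c (snoc w a n) = refl

  increasing-◃ : ∀ c w → Increasing w → Increasing (c ◃ w)
  increasing-◃ c (single a n) _            = tt
  increasing-◃ c (snoc w a n) (incw , w<n) =
    increasing-◃ c w incw , subst (_< n) (sym (last-◃ c w)) w<n

  record JWitness (D : Subset X) (F : List (ℕ → X)) : Set where
    field
      word       : Word X
      tail       : X
      increasing : Increasing word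
      member     : ∀ f → f ∈ F → D (value word f · tail)

  toWord : (k : ℕ) → (Fin (suc (suc k)) → X) → (Fin (suc k) → ℕ) → Word X
  toWord zero    a t = single (a zero) (t zero)
  toWord (suc k) a t =
    snoc (toWord k (a ∘ inject₁) (t ∘ inject₁)) (a (inject₁ (fromℕ (suc k)))) (t (fromℕ (suc k)))

  value-toWord : ∀ k a t f → value (toWord k a t) f ≡ prod SX k a t f
  value-toWord zero    a t f = refl
  value-toWord (suc k) a t f = cong (_· _) (value-toWord k (a ∘ inject₁) (t ∘ inject₁) f)

  last-toWord : ∀ k a t → lastIndex (toWord k a t) ≡ t (fromℕ k)
  last-toWord zero    a t = refl
  last-toWord (suc k) a t = refl

  increasing-toWord : ∀ k a t → Increasingᶠ t → Increasing (toWord k a t)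
  increasing-toWord zero    a t inc = tt
  increasing-toWord (suc k) a t inc =
    increasing-toWord k (a ∘ inject₁) (t ∘ inject₁) (λ i j i<j → inc _ _ (inject₁-< i<j)) ,
    subst (_< t (fromℕ (suc k))) (sym (last-toWord k (a ∘ inject₁) (t ∘ inject₁)))
      (inc _ _ (ℕ<⇒inject₁< (i<1+i (fromℕ k))))

  jWitness : {D : Subset X} → IsJSet SX D → ∀ f₀ Fs → JWitness D (f₀ ∷ Fs)
  jWitness {D} J f₀ Fs with J f₀ Fs
  ... | k , a , t , inc , mem = record
    { word       = toWord k a t
    ; tail       = a (fromℕ (suc k))
    ; increasing = increasing-toWord k a t inc
    ; member     = λ f f∈F → subst D (cong (_· _) (sym (value-toWord k a t f))) (mem f f∈F)
    }

  prod-cong : ∀ k {a a′ : Fin (suc (suc k)) → X} {t t′ : Fin (suc k) → ℕ} f →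
    (∀ i → a i ≡ a′ i) → (∀ i → t i ≡ t′ i) → prod SX k a t f ≡ prod SX k a′ t′ f
  prod-cong zero    f a≡ t≡ = cong₂ _·_ (a≡ zero) (cong f (t≡ zero))
  prod-cong (suc k) f a≡ t≡ =
    cong₂ _·_ (prod-cong k f (a≡ ∘ inject₁) (t≡ ∘ inject₁)) (cong₂ _·_ (a≡ _) (cong f (t≡ _)))

  prod-fromWord : ∀ w z f → prod SX (length w) (coefficients w ▷ z) (indices w) f ≡ value w f
  prod-fromWord (single a n) z f = refl
  prod-fromWord (snoc w a n) z f = cong₂ _·_ init lastLetter
    where
      init = trans (prod-cong (length w) f (▷-inject₁ (coefficients w ▷ a) z) (▷-inject₁ (indices w) n))
                   (prod-fromWord w a f)
      lastLetter = cong₂ (λ b m → b · f m)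
        (trans (▷-inject₁ (coefficients w ▷ a) z (fromℕ (suc (length w))))
               (▷-last (suc (length w)) (coefficients w) a))
        (▷-last (suc (length w)) (indices w) n)

  fromJWitnesses : {D : Subset X} → (∀ f₀ Fs → JWitness D (f₀ ∷ Fs)) → IsJSet SX D
  fromJWitnesses {D} W f₀ Fs =
    length word , coefficients word ▷ tail , indices word , indices-increasing word increasing ,
    λ f f∈F → subst D (cong₂ _·_ (sym (prod-fromWord word tail f))
                                  (sym (▷-last (suc (length word)) (coefficients word) tail)))
                      (member f f∈F)
    where open JWitness (W f₀ Fs)

  -- A J-set has witnesses whose indices all lie beyond any prescribed threshold M:
  -- apply the definition to the shifted sequences n ↦ f(M + n).
  jWitnessAbove : {D : Subset X} → IsJSet SX D → (M : ℕ) → ∀ f₀ Fs →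
    Σ (JWitness D (f₀ ∷ Fs)) λ W → M ≤ firstIndex (JWitness.word W)
  jWitnessAbove {D} J M f₀ Fs = W , subst (M ≤_) (sym (first-shift M word)) (m≤m+n M _)
    where
      shifted = λ (f : ℕ → X) n → f (M + n)
      open JWitness (jWitness {D} J (shifted f₀) (map shifted Fs))
      W : JWitness D (f₀ ∷ Fs)
      W = record
        { word       = shift M word
        ; tail       = tail
        ; increasing = increasing-shift M word increasing
        ; member     = λ f f∈F → subst D (cong (_· tail) (sym (value-shift M word f)))
                                         (member (shifted f) (∈-map⁺ shifted f∈F))
        }

  -- A J-set has a sequence of witnesses occupying pairwise separated windows of
  -- indices: the n-th witness is chosen beyond the last index of the previous one.
  separatedWitnesses : {D : Subset X} → IsJSet SX D → ∀ f₀ Fs →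
    Σ (ℕ → JWitness D (f₀ ∷ Fs)) λ W →
      ∀ m n → m < n → lastIndex (JWitness.word (W m)) < firstIndex (JWitness.word (W n))
  separatedWitnesses {D} J f₀ Fs = W , separated
    where
      above = λ M → jWitnessAbove {D} J M f₀ Fs
      -- Thresholds: the n-th witness starts at or after N n and ends before N (suc n).
      N : ℕ → ℕ
      N zero    = zero
      N (suc n) = suc (lastIndex (JWitness.word (proj₁ (above (N n)))))
      W = λ n → proj₁ (above (N n))
      N≤first = λ n → proj₂ (above (N n))

      N-step : ∀ n → N n ≤ N (suc n)
      N-step n = <⇒≤ (s≤s (≤-trans (N≤first n)
                   (first≤last (JWitness.word (W n)) (JWitness.increasing (W n)))))

      separated : ∀ m n → m < n → lastIndex (JWitness.word (W m)) < firstIndex (JWitness.word (W n))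
      separated m n m<n = ≤-trans (monotone N N-step (≤⇒≤′ m<n)) (N≤first n)

J-superset : {X : Set} (SX : SemigroupOn X) {B B′ : Subset X} → B ⊆ B′ →
  IsJSet SX B → IsJSet SX B′
J-superset SX B⊆B′ J f₀ Fs with J f₀ Fs
... | k , a , t , inc , mem = k , a , t , inc , λ f f∈F → B⊆B′ _ (mem f f∈F)

-- Given blocks (wₙ, zₙ) for n ∈ ℕ, the substitution of a word V = (cⱼ, sⱼ)ⱼ replaces the
-- letter cⱼ·h(sⱼ) by cⱼ·value(w_{sⱼ}, f)·z_{sⱼ}; the tails are absorbed into the next
-- coefficient, so the result is a word U with a tail p.
module Substitution {X : Set} (SX : SemigroupOn X) (block : ℕ → Word X) (blockTail : ℕ → X) where
  open SemigroupOn SX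
  open Words SX

  substitute : Word X → Word X × X
  substitute (single c n) = c ◃ block n , blockTail n
  substitute (snoc V c n) =
    let (U , p) = substitute V in U ++ʷ ((p · c) ◃ block n) , blockTail n

  reassociate : ∀ u p c b z → (u · p) · (c · (b · z)) ≡ (u · ((p · c) · b)) · z
  reassociate u p c b z = begin
    (u · p) · (c · (b · z))  ≡⟨ assoc u p _ ⟩
    u · (p · (c · (b · z)))  ≡⟨ cong (u ·_) (sym (assoc p c _)) ⟩
    u · ((p · c) · (b · z))  ≡⟨ cong (u ·_) (sym (assoc (p · c) b z)) ⟩
    u · (((p · c) · b) · z)  ≡⟨ sym (assoc u _ z) ⟩
    (u · ((p · c) · b)) · z  ∎
    where open ≡-Reasoning

  value-substitute : ∀ f h → (∀ n → h n ≡ value (block n) f · blockTail n) → ∀ V →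
    value V h ≡ value (proj₁ (substitute V)) f · proj₂ (substitute V)
  value-substitute f h h≡ (single c n) = begin
    c · h n                                  ≡⟨ cong (c ·_) (h≡ n) ⟩
    c · (value (block n) f · blockTail n)    ≡⟨ sym (assoc c _ _) ⟩
    (c · value (block n) f) · blockTail n    ≡⟨ cong (_· blockTail n) (sym (value-◃ c (block n) f)) ⟩
    value (c ◃ block n) f · blockTail n      ∎
    where open ≡-Reasoning
  value-substitute f h h≡ (snoc V c n) = begin
    value V h · (c · h n)                                ≡⟨ cong₂ _·_ (value-substitute f h h≡ V) (cong (c ·_) (h≡ n)) ⟩
    (value U f · p) · (c · (value (block n) f · z))      ≡⟨ reassociate (value U f) p c _ z ⟩
    (value U f · ((p · c) · value (block n) f)) · z      ≡⟨ cong (λ x → (value U f · x) · z) (sym (value-◃ (p · c) (block n) f)) ⟩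
    (value U f · value ((p · c) ◃ block n) f) · z        ≡⟨ cong (_· z) (sym (value-++ U ((p · c) ◃ block n) f)) ⟩
    value (U ++ʷ ((p · c) ◃ block n)) f · z              ∎
    where
      open ≡-Reasoning
      U = proj₁ (substitute V)
      p = proj₂ (substitute V)
      z = blockTail n

  last-substitute : ∀ V → lastIndex (proj₁ (substitute V)) ≡ lastIndex (block (lastIndex V))
  last-substitute (single c n) = last-◃ c (block n)
  last-substitute (snoc V c n) = trans (last-++ (proj₁ (substitute V)) (q ◃ block n)) (last-◃ q (block n))
    where q = proj₂ (substitute V) · c

  increasing-substitute : (∀ n → Increasing (block n)) →
    (∀ m n → m < n → lastIndex (block m) < firstIndex (block n)) →
    ∀ V → Increasing V → Increasing (proj₁ (substitute V))
  increasing-substitute incB sep (single c n) _ = increasing-◃ c (block n) (incB n)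
  increasing-substitute incB sep (snoc V c n) (incV , V<n) =
    increasing-++ U (q ◃ block n) (increasing-substitute incB sep V incV)
      (increasing-◃ q (block n) (incB n))
      (subst₂ _<_ (sym (last-substitute V)) (sym (first-◃ q (block n))) (sep _ n V<n))
    where
      U = proj₁ (substitute V)
      q = proj₂ (substitute V) · c

∈-mapWith∈ : {A B : Set} {xs : List A} (g : ∀ {x} → x ∈ xs → B) {x : A} (x∈xs : x ∈ xs) →
  g x∈xs ∈ mapWith∈ xs g
∈-mapWith∈ g (here refl)  = here refl
∈-mapWith∈ g (there x∈xs) = there (∈-mapWith∈ (g ∘ there) x∈xs)

module _ {S T : Set} (SS : SemigroupOn S) (ST : SemigroupOn T) (Φ : S → T)
         (hom : IsHom SS ST Φ) where
  open SemigroupOn ST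
  open SemigroupOn SS using () renaming (_·_ to _·ˢ_)
  private module WS = Words SS
  open Words ST

  value-hom : ∀ V g → Φ (WS.value V g) ≡ value (mapʷ Φ V) (Φ ∘ g)
  value-hom (single a n) g = hom a (g n)
  value-hom (snoc V a n) g =
    trans (hom _ _) (cong₂ _·_ (value-hom V g) (hom a (g n)))

  J-image : IsJSet ST (image Φ (λ _ → ⊤)) → {B : Subset S} → IsJSet SS B →
    IsJSet ST (image Φ B)
  J-image JΦ {B} JB = fromJWitnesses witness
    where
      witness : ∀ f₀ Fs → JWitness (image Φ B) (f₀ ∷ Fs)
      witness f₀ Fs = record
        { word       = U
        ; tail       = p · Φ e
        ; increasing = increasing-substitute blockIncreasing separated (mapʷ Φ V)
                         (increasing-mapʷ Φ V WJ.increasing)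
        ; member     = λ f f∈F → WS.value V (preimage f∈F) ·ˢ e ,
                         WJ.member (preimage f∈F) (∈-mapWith∈ preimage f∈F) ,
                         Φx≡ f f∈F
        }
        where
          F = f₀ ∷ Fs
          blocks = separatedWitnesses {image Φ (λ _ → ⊤)} JΦ f₀ Fs
          blockWitness = proj₁ blocks
          separated = proj₂ blocks
          block = λ n → JWitness.word (blockWitness n)
          blockTail = λ n → JWitness.tail (blockWitness n)
          blockIncreasing = λ n → JWitness.increasing (blockWitness n)

          preimage : ∀ {f} → f ∈ F → ℕ → S
          preimage f∈F n = proj₁ (JWitness.member (blockWitness n) _ f∈F)
          preimage-spec : ∀ {f} (f∈F : f ∈ F) n →
            Φ (preimage f∈F n) ≡ value (block n) f · blockTail n
          preimage-spec f∈F n = proj₂ (proj₂ (JWitness.member (blockWitness n) _ f∈F))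

          WB : WS.JWitness B (mapWith∈ F preimage)
          WB = WS.jWitness {B} JB (preimage (here refl)) (mapWith∈ Fs (preimage ∘ there))
          module WJ = WS.JWitness WB
          V = WJ.word
          e = WJ.tail
          open Substitution ST block blockTail
          U = proj₁ (substitute (mapʷ Φ V))
          p = proj₂ (substitute (mapʷ Φ V))

          Φx≡ : ∀ f (f∈F : f ∈ F) → Φ (WS.value V (preimage f∈F) ·ˢ e) ≡ value U f · (p · Φ e)
          Φx≡ f f∈F = begin
            Φ (WS.value V (preimage f∈F) ·ˢ e)                   ≡⟨ hom _ e ⟩
            Φ (WS.value V (preimage f∈F)) · Φ e                 ≡⟨ cong (_· Φ e) (value-hom V (preimage f∈F)) ⟩
            value (mapʷ Φ V) (Φ ∘ preimage f∈F) · Φ e           ≡⟨ cong (_· Φ e) (value-substitute f _ (preimage-spec f∈F) (mapʷ Φ V)) ⟩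
            (value U f · p) · Φ e                               ≡⟨ assoc _ p (Φ e) ⟩
            value U f · (p · Φ e)                               ∎
            where open ≡-Reasoning

⋂ : {I X : Set} → (I → Subset X) → List I → Subset X
⋂ C L x = ∀ F → F ∈ L → C F x

module _ {S T : Set} (Φ : S → T) where

  image-mono : {A B : Subset S} → A ⊆ B → image Φ A ⊆ image Φ B
  image-mono A⊆B y (s , s∈A , Φs≡y) = s , A⊆B s s∈A , Φs≡y

  image-⋂ : {I : Set} (C : I → Subset S) (L : List I) →
    image Φ (⋂ C L) ⊆ ⋂ (λ F → image Φ (C F)) L
  image-⋂ C L y (s , s∈⋂ , Φs≡y) F F∈L = s , s∈⋂ F F∈L , Φs≡y

  image-⁻¹ : (SS : SemigroupOn S) (ST : SemigroupOn T) → IsHom SS ST Φ →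
    ∀ {C C′ : Subset S} x → C′ ⊆ _⁻¹_ SS x C → image Φ C′ ⊆ _⁻¹_ ST (Φ x) (image Φ C)
  image-⁻¹ SS ST hom x C′⊆x⁻¹C y (s , s∈C′ , refl) =
    SemigroupOn._·_ SS x s , C′⊆x⁻¹C s s∈C′ , hom x s

theorem3p5 : {S T : Set} (SS : SemigroupOn S) (ST : SemigroupOn T) (Φ : S → T) →
    IsHom SS ST Φ →
    IsJSet ST (image Φ (λ _ → ⊤)) →
    (A : Subset S) → IsCSet SS A → IsCSet ST (image Φ A)
theorem3p5 SS ST Φ hom JΦ A cA = record
  { I         = I
  ; _≥_       = _≥_
  ; inhabited = inhabited
  ; ≥-refl    = ≥-refl
  ; ≥-trans   = ≥-trans
  ; directed  = directed
  ; C         = λ F → image Φ (C F)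
  ; C⊆A       = λ F → image-mono Φ (C⊆A F)
  ; downward  = λ F≥G → image-mono Φ (downward F≥G)
  ; cond1     = imageCond1
  ; cond2     = λ F₀ Fs →
      J-superset ST (image-⋂ Φ C (F₀ ∷ Fs)) (J-image SS ST Φ hom JΦ (cond2 F₀ Fs))
  }
  where
    open CSetWitness cA
    imageCond1 : ∀ F y → image Φ (C F) y →
      ∃[ G ] (image Φ (C G) ⊆ _⁻¹_ ST y (image Φ (C F)))
    imageCond1 F _ (x , x∈C , refl) with cond1 F x x∈C
    ... | G , CG⊆x⁻¹CF = G , image-⁻¹ Φ SS ST hom x CG⊆x⁻¹CF
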